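{- Let $n\ge 1$ and consider the Ziggu state graph on $n$ digits (defined in the context). A shortest solution, i.e. a solution with the fewest states, has exactly $6\cdot 2^n-3n-5$ states and therefore $6\cdot 2^n-3n-6$ moves.
   Context: Ziggu state graph on $n$ digits (this models every Ziggu puzzle with $m=n-1$ chained S-shaped mazes). Write strings over $\{0,1,2,3\}$ as $q=q_nq_{n-1}\cdots q_1$, where $q_1$ is the rightmost digit. A state is such a string in which every digit to the right of a $3$ is also a $3$; that is, for $1\le i<n$, $q_{i+1}=3$ implies $q_i=3$. Two states $q,q'$ are adjacent (they differ by one move) iff they agree in all positions except one position $i$, where $\{q_i,q'_i\}=\{a,a+1\}$ for some $a\in\{0,1,2\}$, and, if $i\ge 2$, the common digit $q_{i-1}=q'_{i-1}$ equals $3$ when $a$ is even and equals $0$ when $a$ is odd. The start state is $0^n$ and the solved state is $3^n$ (exponent denotes repetition). A solution is a sequence of pairwise distinct states beginning at $0^n$ and ending at $3^n$ in which consecutive states are adjacent. Its number of states is the length of the sequence, and its number of moves is one less. -}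

module Defs where

open import Data.Nat using (ℕ; zero; suc; _+_; _*_; _∸_; _^_; _≤_; _<_)
open import Data.Fin using (Fin; toℕ; fromℕ<; inject₁) renaming (suc to fsuc; zero to fzero)
open import Data.Vec using (Vec; lookup; replicate)
open import Data.List using (List; []; _∷_; length; head; last)
open import Data.List.Relation.Unary.All using (All)
open import Data.List.Relation.Unary.Linked using (Linked)
open import Data.List.Relation.Unary.Unique.Propositional using (Unique)
open import Data.Maybe using (Maybe; just)
open import Data.Product using (Σ; _×_; _,_)
open import Data.Sum using (_⊎_)
open import Relation.Binary.PropositionalEquality using (_≡_; _≢_)

Digit : Set
Digit = Fin 4

d0 d3 : Digit
d0 = fzero
d3 = fsuc (fsuc (fsuc fzero))

-- A word q = q_n ... q_1 is stored as a vector v with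
-- lookup v i = q_{toℕ i + 1}; i.e. index 0 holds the rightmost digit q_1.
Word : ℕ → Set
Word n = Vec Digit n

-- q_{i+1} = 3 implies q_i = 3 for 1 ≤ i < n.
-- With 0-based index j = i - 1: digit at index j+1 is 3 ⇒ digit at index j is 3.
IsState : ∀ {n} → Word n → Set
IsState {n} q = ∀ (j : Fin n) (k : Fin n) → toℕ k ≡ suc (toℕ j) →
  lookup q k ≡ d3 → lookup q j ≡ d3

-- The required value of q_{i-1} for a move between digits a and a+1:
-- 3 if a is even, 0 if a is odd (a ∈ {0,1,2}).
required : ℕ → Digit
required 1 = d0
required _ = d3

MoveAt : ∀ {n} → Word n → Word n → Fin n → ℕ → Set
MoveAt {n} q q' i a =
  a < 3
  × ((toℕ (lookup q i) ≡ a × toℕ (lookup q' i) ≡ suc a)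
     ⊎ (toℕ (lookup q i) ≡ suc a × toℕ (lookup q' i) ≡ a))
  × (∀ (j : Fin n) → j ≢ i → lookup q j ≡ lookup q' j)
  × (∀ (j : Fin n) → toℕ i ≡ suc (toℕ j) → lookup q j ≡ required a)

Adjacent : ∀ {n} → Word n → Word n → Set
Adjacent {n} q q' = Σ (Fin n) λ i → Σ ℕ λ a → MoveAt q q' i a

record Solution (n : ℕ) : Set where
  field
    states   : List (Word n)
    allState : All IsState states
    distinct : Unique states
    starts   : head states ≡ just (replicate n d0)
    ends     : last states ≡ just (replicate n d3)
    chain    : Linked Adjacent states

numStates : ∀ {n} → Solution n → ℕ
numStates s = length (Solution.states s)

numMoves : ∀ {n} → Solution n → ℕ
numMoves s = numStates s ∸ 1

-- Delete the top digit of every state of a solution: consecutive states become equal or adjacent,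
-- so the lower n − 1 digits perform a walk. The top digit has to move 0 → 1, 1 → 2 and 2 → 3, and
-- these moves require the digit below it to be 3, 0 and 3 respectively. So apart from those three
-- moves the lower digits walk from 0ⁿ⁻¹ to a state with top digit 3, then from there to a state with
-- top digit 0, and back to one with top digit 3. Running the same argument backwards, every walk
-- from a state with top digit 3 to one with top digit 0 has at least descentLength n moves, where
-- descentLength (n + 1) = 2 · descentLength n + 3, and every solution has at least solveLength n
-- moves, where solveLength (n + 1) = solveLength n + descentLength (n + 1). Performing exactly these
-- moves recursively attains the bounds, and cutting out cycles turns the walk into a solution.
-- The recurrences solve to 3 · 2ⁿ − 3 and 6 · 2ⁿ − 3n − 6.

module Submission where

open import Defs
open import Data.Nat using (ℕ; zero; suc; _+_; _*_; _∸_; _^_; _≤_; _<_; _≤?_; z≤n; s≤s; s≤s⁻¹)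
open import Data.Nat.Properties
  using (≤-refl; ≤-trans; ≤-reflexive; ≤-antisym; ≤⇒≯; ≮⇒≥; <-irrefl; 1+n≢n; n≮n;
         <-asym; suc-injective; m≤n⇒m≤1+n; +-mono-≤; +-monoˡ-≤; m+n≤o⇒n≤o; m+n∸n≡m)
open import Data.Nat.Tactic.RingSolver using (solve-∀)
open import Data.Fin using (Fin; toℕ; fromℕ; inject₁; _≟_) renaming (suc to fsuc; zero to fzero)
open import Data.Fin.Properties
  using (toℕ-fromℕ; toℕ-inject₁; toℕ-injective; toℕ<n; fromℕ≢inject₁; inject₁-injective)
open import Data.Fin.Relation.Unary.Top using (view; ‵fromℕ; ‵inject₁)
open import Data.Vec using (Vec; []; _∷_; lookup; replicate; _∷ʳ_; init; last; initLast)
open import Data.Vec.Properties using (lookup-replicate; ≡-dec)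
open import Data.Vec.Relation.Binary.Pointwise.Extensional using (ext; Pointwise-≡⇒≡)
open import Data.List using (List; []; _∷_; length)
import Data.List as List
open import Data.List.Relation.Unary.All using (All; []; _∷_)
open import Data.List.Relation.Unary.All.Properties using (¬Any⇒All¬)
open import Data.List.Relation.Unary.Any using (here; there)
open import Data.List.Relation.Unary.Linked using (Linked; [-]; _∷_)
open import Data.List.Relation.Unary.AllPairs using ([]; _∷_)
open import Data.List.Relation.Unary.Unique.Propositional using (Unique)
open import Data.List.Membership.Propositional using (_∈_)
open import Data.List.Membership.DecPropositional using (_∈?_)
open import Data.Maybe using (just)
open import Data.Product using (Σ; ∃-syntax; _×_; _,_; proj₁; proj₂)
open import Data.Sum using (_⊎_; inj₁; inj₂)
import Data.Sum as Sum
open import Data.Empty using (⊥-elim)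
open import Function using (_∘_)
open import Relation.Nullary using (¬_; yes; no)
open import Relation.Unary using (Decidable)
open import Relation.Binary.Definitions using (Symmetric; DecidableEquality)
open import Relation.Binary.PropositionalEquality

data Walk {V : Set} (Ok : V → Set) (E : V → V → Set) : V → V → ℕ → Set where
  done : ∀ {x} → Ok x → Walk Ok E x x 0
  step : ∀ {x y z k} → Ok x → E x y → Walk Ok E y z k → Walk Ok E x z (suc k)

module _ {V : Set} {Ok : V → Set} {E : V → V → Set} where

  target-ok : ∀ {x y k} → Walk Ok E x y k → Ok y
  target-ok (done o)     = o
  target-ok (step _ _ w) = target-ok w

  infixr 5 _++ʷ_

  _++ʷ_ : ∀ {x y z k m} → Walk Ok E x y k → Walk Ok E y z m → Walk Ok E x z (k + m)
  done _     ++ʷ w′ = w′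
  step o e w ++ʷ w′ = step o e (w ++ʷ w′)

  snocʷ : ∀ {x y z k} → Walk Ok E x y k → E y z → Ok z → Walk Ok E x z (suc k)
  snocʷ (done o)     e oz = step o e (done oz)
  snocʷ (step o e w) e′ oz = step o e (snocʷ w e′ oz)

  reverseʷ : Symmetric E → ∀ {x y k} → Walk Ok E x y k → Walk Ok E y x k
  reverseʷ sym (done o)     = done o
  reverseʷ sym (step o e w) = snocʷ (reverseʷ sym w) (sym e) o

  vertices : ∀ {x y k} → Walk Ok E x y k → List V
  vertices (done {x} _)     = x ∷ []
  vertices (step {x} _ _ w) = x ∷ vertices w

  length-vertices : ∀ {x y k} (w : Walk Ok E x y k) → length (vertices w) ≡ suc k
  length-vertices (done _)     = refl
  length-vertices (step _ _ w) = cong suc (length-vertices w)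

  head-vertices : ∀ {x y k} (w : Walk Ok E x y k) → List.head (vertices w) ≡ just x
  head-vertices (done _)     = refl
  head-vertices (step _ _ _) = refl

  last-vertices : ∀ {x y k} (w : Walk Ok E x y k) → List.last (vertices w) ≡ just y
  last-vertices (done _)              = refl
  last-vertices (step _ _ (done _))   = refl
  last-vertices (step _ _ w@(step _ _ _)) = last-vertices w

  vertices-ok : ∀ {x y k} (w : Walk Ok E x y k) → All Ok (vertices w)
  vertices-ok (done o)     = o ∷ []
  vertices-ok (step o _ w) = o ∷ vertices-ok w

  vertices-linked : ∀ {x y k} (w : Walk Ok E x y k) → Linked E (vertices w)
  vertices-linked (done _)              = [-]
  vertices-linked (step _ e (done _))   = e ∷ [-]
  vertices-linked (step _ e w@(step _ _ _)) = e ∷ vertices-linked w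

  fromLinked : ∀ {x y} xs → Linked E (x ∷ xs) → All Ok (x ∷ xs) →
               List.last (x ∷ xs) ≡ just y → Walk Ok E x y (length xs)
  fromLinked []       [-]     (o ∷ []) refl = done o
  fromLinked (_ ∷ xs) (e ∷ l) (o ∷ os) eq   = step o e (fromLinked xs l os eq)

  record Entry (P : V → Set) (a b : V) (k : ℕ) : Set where
    constructor entry
    field
      {x y}    : V
      {k₁ k₂}  : ℕ
      before   : Walk Ok E a x k₁
      edge     : E x y
      outside  : ¬ P x
      inside   : P y
      after    : Walk Ok E y b k₂
      length-≡ : k ≡ k₁ + suc k₂

  firstEntry : ∀ {P : V → Set} → Decidable P →
               ∀ {a b k} → Walk Ok E a b k → ¬ P a → P b → Entry P a b k
  firstEntry P? (done _) ¬pa pb = ⊥-elim (¬pa pb)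
  firstEntry P? (step {y = y} o e w) ¬pa pb with P? y
  ... | yes py = entry (done o) e ¬pa py w refl
  ... | no ¬py with firstEntry P? w ¬py pb
  ...   | entry before e′ out in′ after eq = entry (step o e before) e′ out in′ after (cong suc eq)

  PathWithin : V → V → ℕ → Set
  PathWithin a b k = ∃[ k′ ] k′ ≤ k × Σ (Walk Ok E a b k′) (Unique ∘ vertices)

  suffixPath : ∀ {a b c k} (w : Walk Ok E a b k) → c ∈ vertices w → Unique (vertices w) →
               PathWithin c b k
  suffixPath w@(done _)     (here refl) u       = _ , ≤-refl , w , u
  suffixPath w@(step _ _ _) (here refl) u       = _ , ≤-refl , w , u
  suffixPath (step _ _ w)   (there c∈)  (_ ∷ u) =
    let k′ , k′≤ , path = suffixPath w c∈ u in k′ , m≤n⇒m≤1+n k′≤ , path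

  shortcut : DecidableEquality V → ∀ {a b k} → Walk Ok E a b k → PathWithin a b k
  shortcut _≟ᵥ_ (done o) = 0 , ≤-refl , done o , [] ∷ []
  shortcut _≟ᵥ_ (step {x} o e w) with shortcut _≟ᵥ_ w
  ... | k′ , k′≤ , w′ , u with _∈?_ _≟ᵥ_ x (vertices w′)
  ...   | yes x∈ = let k″ , k″≤ , path = suffixPath w′ x∈ u
                   in k″ , m≤n⇒m≤1+n (≤-trans k″≤ k′≤) , path
  ...   | no  x∉ = suc k′ , s≤s k′≤ , step o e w′ , ¬Any⇒All¬ _ x∉ ∷ u

module _ {V W : Set} {Ok : V → Set} {E : V → V → Set} {Ok′ : W → Set} {E′ : W → W → Set}
         (f : V → W) (ok : ∀ {x} → Ok x → Ok′ (f x)) where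

  mapWalk : (∀ {x y} → E x y → E′ (f x) (f y)) →
            ∀ {a b k} → Walk Ok E a b k → Walk Ok′ E′ (f a) (f b) k
  mapWalk edge (done o)     = done (ok o)
  mapWalk edge (step o e w) = step (ok o) (edge e) (mapWalk edge w)

  contractWalk : (∀ {x y} → E x y → f x ≡ f y ⊎ E′ (f x) (f y)) →
                 ∀ {a b k} → Walk Ok E a b k → ∃[ k′ ] k′ ≤ k × Walk Ok′ E′ (f a) (f b) k′
  contractWalk edge (done o) = 0 , z≤n , done (ok o)
  contractWalk edge {b = b} (step o e w) with contractWalk edge w | edge e
  ... | k′ , k′≤ , w′ | inj₁ same =
    k′ , m≤n⇒m≤1+n k′≤ , subst (λ v → Walk Ok′ E′ v (f b) k′) (sym same) w′
  ... | k′ , k′≤ , w′ | inj₂ e′   = suc k′ , s≤s k′≤ , step (ok o) e′ w′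

-- Since index 0 holds q₁, a word v ∷ʳ x has top digit x above the lower digits v.

lookup-∷ʳ-inject₁ : ∀ {A : Set} {n} (v : Vec A n) x (j : Fin n) →
                    lookup (v ∷ʳ x) (inject₁ j) ≡ lookup v j
lookup-∷ʳ-inject₁ (_ ∷ _) x fzero    = refl
lookup-∷ʳ-inject₁ (_ ∷ v) x (fsuc j) = lookup-∷ʳ-inject₁ v x j

lookup-∷ʳ-fromℕ : ∀ {A : Set} {n} (v : Vec A n) x → lookup (v ∷ʳ x) (fromℕ n) ≡ x
lookup-∷ʳ-fromℕ []      x = refl
lookup-∷ʳ-fromℕ (_ ∷ v) x = lookup-∷ʳ-fromℕ v x

∷ʳ-init-last : ∀ {A : Set} {n} (q : Vec A (suc n)) → q ≡ init q ∷ʳ last q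
∷ʳ-init-last q = proj₂ (proj₂ (initLast q))

replicate-∷ʳ : ∀ {A : Set} n (x : A) → replicate n x ∷ʳ x ≡ replicate (suc n) x
replicate-∷ʳ zero    x = refl
replicate-∷ʳ (suc n) x = cong (x ∷_) (replicate-∷ʳ n x)

init-replicate : ∀ {A : Set} n (x : A) → init (replicate (suc n) x) ≡ replicate n x
init-replicate zero    x = refl
init-replicate (suc n) x = cong (x ∷_) (init-replicate n x)

fromℕ-is-topmost : ∀ {n} (k : Fin (suc n)) → toℕ k ≢ suc (toℕ (fromℕ n))
fromℕ-is-topmost {n} k e = <-irrefl (trans e (cong suc (toℕ-fromℕ n))) (toℕ<n k)

inject₁-below : ∀ {n} {j k : Fin n} →
                toℕ k ≡ suc (toℕ j) → toℕ (inject₁ k) ≡ suc (toℕ (inject₁ j))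
inject₁-below {j = j} {k} e rewrite toℕ-inject₁ j | toℕ-inject₁ k = e

inject₁-below⁻ : ∀ {n} {j k : Fin n} →
                 toℕ (inject₁ k) ≡ suc (toℕ (inject₁ j)) → toℕ k ≡ suc (toℕ j)
inject₁-below⁻ {j = j} {k} e rewrite toℕ-inject₁ j | toℕ-inject₁ k = e

d1 d2 : Digit
d1 = fsuc fzero
d2 = fsuc (fsuc fzero)

StateWalk : ∀ n → Word n → Word n → ℕ → Set
StateWalk n = Walk (IsState {n}) (Adjacent {n})

-- Toggle and BelowIs are the second and the last clause of Defs.MoveAt.
Toggle : ℕ → Digit → Digit → Set
Toggle a x y = (toℕ x ≡ a × toℕ y ≡ suc a) ⊎ (toℕ x ≡ suc a × toℕ y ≡ a)

Toggle-sym : ∀ {a x y} → Toggle a x y → Toggle a y x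
Toggle-sym (inj₁ (p , q)) = inj₂ (q , p)
Toggle-sym (inj₂ (p , q)) = inj₁ (q , p)

-- Vacuous for the empty word, just as the side condition of a move of q₁.
record TopIs {n} (d : Digit) (v : Word n) : Set where
  constructor top-is
  field at-top : ∀ j → n ≡ suc (toℕ j) → lookup v j ≡ d
open TopIs

BelowIs : ∀ {n} → Word n → Fin n → Digit → Set
BelowIs q i d = ∀ j → toℕ i ≡ suc (toℕ j) → lookup q j ≡ d

TopMove : ∀ {n} → Word n → Digit → Digit → Set
TopMove v x y = Σ ℕ λ a → Toggle a x y × TopIs (required a) v

module _ {n : ℕ} where

  TopIs-∷ʳ : ∀ (v : Word n) x → TopIs x (v ∷ʳ x)
  TopIs-∷ʳ v x = top-is λ j e →
    subst (λ i → lookup (v ∷ʳ x) i ≡ x) (sym (j≡top e)) (lookup-∷ʳ-fromℕ v x)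
    where
    j≡top : ∀ {j} → suc n ≡ suc (toℕ j) → j ≡ fromℕ n
    j≡top e = toℕ-injective (trans (sym (suc-injective e)) (sym (toℕ-fromℕ n)))

  TopIs-∷ʳ⁻ : ∀ {d x} {v : Word n} → TopIs d (v ∷ʳ x) → x ≡ d
  TopIs-∷ʳ⁻ {x = x} {v} t =
    trans (sym (lookup-∷ʳ-fromℕ v x)) (at-top t (fromℕ n) (cong suc (sym (toℕ-fromℕ n))))

  TopIs-replicate : ∀ x → TopIs x (replicate n x)
  TopIs-replicate x = top-is λ j _ → lookup-replicate j x

  BelowIs-fromℕ : ∀ {d x} {v : Word n} → TopIs d v → BelowIs (v ∷ʳ x) (fromℕ n) d
  BelowIs-fromℕ {x = x} {v} t j e with view j
  ... | ‵fromℕ      = ⊥-elim (fromℕ-is-topmost (fromℕ n) e)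
  ... | ‵inject₁ j′ = trans (lookup-∷ʳ-inject₁ v x j′)
                        (at-top t j′ (trans (sym (toℕ-fromℕ n)) (trans e (cong suc (toℕ-inject₁ j′)))))

  BelowIs-fromℕ⁻ : ∀ {d x} {v : Word n} → BelowIs (v ∷ʳ x) (fromℕ n) d → TopIs d v
  BelowIs-fromℕ⁻ {x = x} {v} b = top-is λ j e → trans (sym (lookup-∷ʳ-inject₁ v x j))
    (b (inject₁ j) (trans (toℕ-fromℕ n) (trans e (cong suc (sym (toℕ-inject₁ j))))))

  BelowIs-inject₁ : ∀ {d x i} {v : Word n} → BelowIs v i d → BelowIs (v ∷ʳ x) (inject₁ i) d
  BelowIs-inject₁ {x = x} {i} {v} b j e with view j
  ... | ‵fromℕ      = ⊥-elim (fromℕ-is-topmost (inject₁ i) e)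
  ... | ‵inject₁ j′ = trans (lookup-∷ʳ-inject₁ v x j′) (b j′ (inject₁-below⁻ e))

  BelowIs-inject₁⁻ : ∀ {d x i} {v : Word n} → BelowIs (v ∷ʳ x) (inject₁ i) d → BelowIs v i d
  BelowIs-inject₁⁻ {x = x} {v = v} b j e =
    trans (sym (lookup-∷ʳ-inject₁ v x j)) (b (inject₁ j) (inject₁-below e))

  IsState-replicate : IsState (replicate n d3)
  IsState-replicate j _ _ _ = lookup-replicate j d3

  IsState-∷ʳ : ∀ {x} {v : Word n} → x ≢ d3 → IsState v → IsState (v ∷ʳ x)
  IsState-∷ʳ {x} {v} x≢3 st j k e h with view k | view j
  ... | ‵fromℕ      | _           = ⊥-elim (x≢3 (trans (sym (lookup-∷ʳ-fromℕ v x)) h))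
  ... | ‵inject₁ k′ | ‵fromℕ      = ⊥-elim (fromℕ-is-topmost (inject₁ k′) e)
  ... | ‵inject₁ k′ | ‵inject₁ j′ = trans (lookup-∷ʳ-inject₁ v x j′)
                                      (st j′ k′ (inject₁-below⁻ e) (trans (sym (lookup-∷ʳ-inject₁ v x k′)) h))

  IsState-∷ʳ⁻ : ∀ {x} {v : Word n} → IsState (v ∷ʳ x) → IsState v
  IsState-∷ʳ⁻ {x} {v} st j k e h = trans (sym (lookup-∷ʳ-inject₁ v x j))
    (st (inject₁ j) (inject₁ k) (inject₁-below e) (trans (lookup-∷ʳ-inject₁ v x k) h))

  Adjacent-sym : Symmetric (Adjacent {n})
  Adjacent-sym (i , a , a<3 , toggle , same , below) =
    i , a , a<3 , Toggle-sym toggle , (λ j j≢i → sym (same j j≢i)) ,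
    λ j e → trans (sym (same j (λ { refl → 1+n≢n (sym e) }))) (below j e)

  reverseState : ∀ {u v k} → StateWalk n u v k → StateWalk n v u k
  reverseState = reverseʷ (λ {x} {y} → Adjacent-sym {x} {y})

  Adjacent-∷ʳ : ∀ {x} {v v′ : Word n} → Adjacent v v′ → Adjacent (v ∷ʳ x) (v′ ∷ʳ x)
  Adjacent-∷ʳ {x} {v} {v′} (i , a , a<3 , toggle , same , below) =
    inject₁ i , a , a<3 ,
    subst₂ (Toggle a) (sym (lookup-∷ʳ-inject₁ v x i)) (sym (lookup-∷ʳ-inject₁ v′ x i)) toggle ,
    same′ , BelowIs-inject₁ {x = x} {v = v} below
    where
    same′ : ∀ j → j ≢ inject₁ i → lookup (v ∷ʳ x) j ≡ lookup (v′ ∷ʳ x) j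
    same′ j j≢i with view j
    ... | ‵fromℕ      = trans (lookup-∷ʳ-fromℕ v x) (sym (lookup-∷ʳ-fromℕ v′ x))
    ... | ‵inject₁ j′ = trans (lookup-∷ʳ-inject₁ v x j′)
                          (trans (same j′ (j≢i ∘ cong inject₁)) (sym (lookup-∷ʳ-inject₁ v′ x j′)))

  Adjacent-top : ∀ {a x y} {v : Word n} → a < 3 → Toggle a x y → TopIs (required a) v →
                 Adjacent (v ∷ʳ x) (v ∷ʳ y)
  Adjacent-top {a} {x} {y} {v} a<3 toggle top =
    fromℕ n , a , a<3 ,
    subst₂ (Toggle a) (sym (lookup-∷ʳ-fromℕ v x)) (sym (lookup-∷ʳ-fromℕ v y)) toggle ,
    same , BelowIs-fromℕ {x = x} {v} top
    where
    same : ∀ j → j ≢ fromℕ n → lookup (v ∷ʳ x) j ≡ lookup (v ∷ʳ y) j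
    same j j≢top with view j
    ... | ‵fromℕ      = ⊥-elim (j≢top refl)
    ... | ‵inject₁ j′ = trans (lookup-∷ʳ-inject₁ v x j′) (sym (lookup-∷ʳ-inject₁ v y j′))

  upStep : ∀ x y {v : Word n} {z k} → toℕ y ≡ suc (toℕ x) → IsState v → TopIs (required (toℕ x)) v →
           StateWalk (suc n) (v ∷ʳ y) z k → StateWalk (suc n) (v ∷ʳ x) z (suc k)
  upStep x y {v} up sv top =
    step (IsState-∷ʳ {v = v} x≢3 sv) (Adjacent-top x<3 (inj₁ (refl , up)) top)
    where
    x<3 : toℕ x < 3
    x<3 = s≤s⁻¹ (subst (_< 4) up (toℕ<n y))
    x≢3 : x ≢ d3
    x≢3 x≡3 = <-irrefl (cong toℕ x≡3) x<3

  Adjacent-∷ʳ⁻ : ∀ {x x′} {v v′ : Word n} → Adjacent (v ∷ʳ x) (v′ ∷ʳ x′) →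
                 (v ≡ v′ × TopMove v x x′) ⊎ (x ≡ x′ × Adjacent v v′)
  Adjacent-∷ʳ⁻ {x} {x′} {v} {v′} (i , a , a<3 , toggle , same , below) with view i
  ... | ‵fromℕ =
    inj₁ (Pointwise-≡⇒≡ (ext lower-same) , a ,
          subst₂ (Toggle a) (lookup-∷ʳ-fromℕ v x) (lookup-∷ʳ-fromℕ v′ x′) toggle ,
          BelowIs-fromℕ⁻ {x = x} {v} below)
    where
    lower-same : ∀ j → lookup v j ≡ lookup v′ j
    lower-same j = trans (sym (lookup-∷ʳ-inject₁ v x j))
      (trans (same (inject₁ j) (fromℕ≢inject₁ ∘ sym)) (lookup-∷ʳ-inject₁ v′ x′ j))
  ... | ‵inject₁ i′ =
    inj₂ (top-same , i′ , a , a<3 ,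
          subst₂ (Toggle a) (lookup-∷ʳ-inject₁ v x i′) (lookup-∷ʳ-inject₁ v′ x′ i′) toggle ,
          lower-same , BelowIs-inject₁⁻ {x = x} {v = v} below)
    where
    top-same : x ≡ x′
    top-same = trans (sym (lookup-∷ʳ-fromℕ v x))
      (trans (same (fromℕ n) fromℕ≢inject₁) (lookup-∷ʳ-fromℕ v′ x′))
    lower-same : ∀ j → j ≢ i′ → lookup v j ≡ lookup v′ j
    lower-same j j≢i = trans (sym (lookup-∷ʳ-inject₁ v x j))
      (trans (same (inject₁ j) (j≢i ∘ inject₁-injective)) (lookup-∷ʳ-inject₁ v′ x′ j))

  IsState-init : ∀ {q : Word (suc n)} → IsState q → IsState (init q)
  IsState-init {q} = IsState-∷ʳ⁻ {x = last q} {v = init q} ∘ subst IsState (∷ʳ-init-last q)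

  TopIs-last : ∀ {d} {q : Word (suc n)} → TopIs d q → last q ≡ d
  TopIs-last {d} {q} = TopIs-∷ʳ⁻ {x = last q} {v = init q} ∘ subst (TopIs d) (∷ʳ-init-last q)

  Adjacent-split : ∀ {q q′ : Word (suc n)} → Adjacent q q′ →
                   (init q ≡ init q′ × TopMove (init q) (last q) (last q′)) ⊎
                   (last q ≡ last q′ × Adjacent (init q) (init q′))
  Adjacent-split {q} {q′} = Adjacent-∷ʳ⁻ ∘ subst₂ Adjacent (∷ʳ-init-last q) (∷ʳ-init-last q′)

  project : ∀ {q q′ k} → StateWalk (suc n) q q′ k →
            ∃[ k′ ] k′ ≤ k × StateWalk n (init q) (init q′) k′
  project = contractWalk init IsState-init (Sum.map proj₁ proj₂ ∘ Adjacent-split)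

  topCrossing : ∀ {b} {q q′ : Word (suc n)} → Adjacent q q′ →
                toℕ (last q) ≤ b → suc b ≤ toℕ (last q′) →
                init q ≡ init q′ × toℕ (last q′) ≡ suc b × TopIs (required b) (init q)
  topCrossing {b} {q} adj ≤b b< with Adjacent-split adj
  ... | inj₂ (same , _) = ⊥-elim (n≮n b (≤-trans b< (subst (λ d → toℕ d ≤ b) same ≤b)))
  ... | inj₁ (same , a , inj₁ (x≡a , y≡1+a) , top) =
    same , trans y≡1+a (cong suc a≡b) , subst (λ c → TopIs (required c) (init q)) a≡b top
    where
    a≡b : a ≡ b
    a≡b = ≤-antisym (subst (_≤ b) x≡a ≤b) (s≤s⁻¹ (subst (suc b ≤_) y≡1+a b<))
  ... | inj₁ (_ , a , inj₂ (x≡1+a , y≡a) , _) =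
    ⊥-elim (<-asym (subst (_≤ b) x≡1+a ≤b) (subst (suc b ≤_) y≡a b<))

  record Crossing (b : ℕ) (q q′ : Word (suc n)) (k : ℕ) : Set where
    constructor crossing
    field
      {x y}     : Word (suc n)
      {k₁ k₂}   : ℕ
      before    : StateWalk (suc n) q x k₁
      after     : StateWalk (suc n) y q′ k₂
      same-init : init x ≡ init y
      top-after : toℕ (last y) ≡ suc b
      lower     : TopIs (required b) (init x)
      length-≡  : k ≡ k₁ + suc k₂

  cross : ∀ b {q q′ k} → StateWalk (suc n) q q′ k →
          toℕ (last q) ≤ b → suc b ≤ toℕ (last q′) → Crossing b q q′ k
  cross b w ≤b b< with firstEntry (λ y → suc b ≤? toℕ (last y)) w (≤⇒≯ ≤b) b<
  ... | entry before edge outside inside after eq with topCrossing edge (≮⇒≥ outside) inside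
  ...   | same , top , lower = crossing before after same top lower eq

-- Lower bounds

descentLength : ℕ → ℕ
descentLength zero    = 0
descentLength (suc n) = suc (descentLength n + suc (descentLength n + 1))

solveLength : ℕ → ℕ
solveLength zero    = 0
solveLength (suc n) = solveLength n + descentLength (suc n)

DescentBound : ℕ → Set
DescentBound n = ∀ {u u′ k} → StateWalk n u u′ k → TopIs d3 u → TopIs d0 u′ → descentLength n ≤ k

climb : ∀ {n q q′ k} → DescentBound n → StateWalk (suc n) q q′ k → TopIs d0 q → TopIs d3 q′ →
        Σ (Word n) λ u → TopIs d3 u ×
          ∃[ k₀ ] StateWalk n (init q) u k₀ × k₀ + descentLength (suc n) ≤ k
climb {n} descent w bottom top
  with ≤-reflexive (cong toℕ (TopIs-last bottom)) | ≤-reflexive (cong toℕ (sym (TopIs-last top)))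
... | at-0 | at-3
  with cross 0 w at-0 (≤-trans (s≤s z≤n) at-3)
... | crossing {x₁} before₁ after₁ same₁ top₁ lower₁ refl
  with cross 1 after₁ (≤-reflexive top₁) (≤-trans (s≤s (s≤s z≤n)) at-3)
... | crossing before₂ after₂ same₂ top₂ lower₂ refl
  with cross 2 after₂ (≤-reflexive top₂) at-3
... | crossing before₃ _ _ _ lower₃ refl
  with project before₁ | project before₂ | project before₃
... | k₀ , k₀≤ , walk₀ | k₂ , k₂≤ , walk₂ | k₃ , k₃≤ , walk₃ =
  init x₁ , lower₁ , k₀ , walk₀ ,
  +-mono-≤ k₀≤ (s≤s (+-mono-≤ (≤-trans bound₂ k₂≤)
                (s≤s (+-mono-≤ (≤-trans bound₃ k₃≤) (s≤s z≤n)))))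
  where
  bound₂ : descentLength n ≤ k₂
  bound₂ = descent walk₂ (subst (TopIs d3) same₁ lower₁) lower₂
  bound₃ : descentLength n ≤ k₃
  bound₃ = descent (reverseState walk₃) lower₃ (subst (TopIs d0) same₂ lower₂)

descentBound : ∀ n → DescentBound n
descentBound zero    _ _ _ = z≤n
descentBound (suc n) w top3 top0 =
  let _ , _ , k₀ , _ , bound = climb (descentBound n) (reverseState w) top0 top3
  in m+n≤o⇒n≤o k₀ bound

solveBound : ∀ n {q k} → StateWalk n (replicate n d0) q k → TopIs d3 q → solveLength n ≤ k
solveBound zero    _ _    = z≤n
solveBound (suc n) w top3 =
  let u , u3 , k₀ , lower , bound = climb (descentBound n) w (TopIs-replicate d0) top3
      lower′ = subst (λ v → StateWalk n v u k₀) (init-replicate n d0) lower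
  in ≤-trans (+-monoˡ-≤ (descentLength (suc n)) (solveBound n lower′ u3)) bound

-- Walks attaining the bounds

liftWalk : ∀ {n v v′ k} x → x ≢ d3 → StateWalk n v v′ k → StateWalk (suc n) (v ∷ʳ x) (v′ ∷ʳ x) k
liftWalk x x≢3 =
  mapWalk (_∷ʳ x) (λ {v} → IsState-∷ʳ {v = v} x≢3) (λ {v} {v′} → Adjacent-∷ʳ {v = v} {v′})

canonicalClimb : ∀ {n u w k d} →
                 StateWalk n u (replicate n d3) k → StateWalk n (replicate n d3) w d → TopIs d0 w →
                 StateWalk (suc n) (u ∷ʳ d0) (replicate (suc n) d3) (k + suc (d + suc (d + 1)))
canonicalClimb {n} {u} solve descent w0 =
  subst (λ z → StateWalk (suc n) (u ∷ʳ d0) z _) (replicate-∷ʳ n d3)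
    (liftWalk d0 (λ ()) solve ++ʷ
     upStep d0 d1 refl IsState-replicate (TopIs-replicate d3)
     (liftWalk d1 (λ ()) descent ++ʷ
      upStep d1 d2 refl (target-ok descent) w0
      (liftWalk d2 (λ ()) (reverseState descent) ++ʷ
       upStep d2 d3 refl IsState-replicate (TopIs-replicate d3)
       (done (subst IsState (sym (replicate-∷ʳ n d3)) IsState-replicate)))))

canonicalDescent : ∀ n → Σ (Word n) λ w → TopIs d0 w × StateWalk n (replicate n d3) w (descentLength n)
canonicalDescent zero    = [] , top-is (λ ()) , done (λ ())
canonicalDescent (suc n) =
  let w , w0 , descent = canonicalDescent n
  in replicate n d3 ∷ʳ d0 , TopIs-∷ʳ _ d0 ,
     reverseState (canonicalClimb (done IsState-replicate) descent w0)

canonicalSolve : ∀ n → StateWalk n (replicate n d0) (replicate n d3) (solveLength n)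
canonicalSolve zero    = done (λ ())
canonicalSolve (suc n) =
  let w , w0 , descent = canonicalDescent n
  in subst (λ u → StateWalk (suc n) u (replicate (suc n) d3) (solveLength (suc n)))
           (replicate-∷ʳ n d0) (canonicalClimb (canonicalSolve n) descent w0)

-- Shortest solutions

pathSolution : ∀ {n k} (w : StateWalk n (replicate n d0) (replicate n d3) k) →
               Unique (vertices w) → Solution n
pathSolution w unique = record
  { states = vertices w ; allState = vertices-ok w ; distinct = unique
  ; starts = head-vertices w ; ends = last-vertices w ; chain = vertices-linked w }

solutionWalk : ∀ {n} (s : Solution n) →
               ∃[ k ] StateWalk n (replicate n d0) (replicate n d3) k × numStates s ≡ suc k
solutionWalk s
  with Solution.states s | Solution.starts s | Solution.chain s | Solution.allState s | Solution.ends s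
... | []     | ()   | _     | _  | _
... | _ ∷ xs | refl | chain | ok | ends = length xs , fromLinked xs chain ok ends , refl

solutionBound : ∀ {n} (s : Solution n) → suc (solveLength n) ≤ numStates s
solutionBound {n} s =
  let k , w , states≡ = solutionWalk s
  in subst (suc (solveLength n) ≤_) (sym states≡) (s≤s (solveBound n w (TopIs-replicate d3)))

shortestSolution : ∀ n → Σ (Solution n) λ s → numStates s ≡ suc (solveLength n)
shortestSolution n =
  let k , k≤ , w , unique = shortcut (≡-dec _≟_) (canonicalSolve n)
      s = pathSolution w unique
  in s , ≤-antisym (≤-trans (≤-reflexive (length-vertices w)) (s≤s k≤)) (solutionBound s)

descentLength-closed : ∀ n → descentLength n + 3 ≡ 3 * 2 ^ n
descentLength-closed zero    = refl
descentLength-closed (suc n) = begin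
  suc (d + suc (d + 1)) + 3 ≡⟨ regroup d ⟩
  (d + 3) + (d + 3)         ≡⟨ cong₂ _+_ (descentLength-closed n) (descentLength-closed n) ⟩
  3 * 2 ^ n + 3 * 2 ^ n     ≡⟨ double (2 ^ n) ⟩
  3 * 2 ^ suc n             ∎
  where
  open ≡-Reasoning
  d = descentLength n
  regroup : ∀ d → suc (d + suc (d + 1)) + 3 ≡ (d + 3) + (d + 3)
  regroup = solve-∀
  double : ∀ p → 3 * p + 3 * p ≡ 3 * (2 * p)
  double = solve-∀

solveLength-closed : ∀ n → solveLength n + (3 * n + 6) ≡ 6 * 2 ^ n
solveLength-closed zero    = refl
solveLength-closed (suc n) = begin
  s + d + (3 * suc n + 6)     ≡⟨ regroup s d n ⟩
  (s + (3 * n + 6)) + (d + 3) ≡⟨ cong₂ _+_ (solveLength-closed n) (descentLength-closed (suc n)) ⟩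
  6 * 2 ^ n + 3 * 2 ^ suc n   ≡⟨ combine (2 ^ n) ⟩
  6 * 2 ^ suc n               ∎
  where
  open ≡-Reasoning
  s = solveLength n
  d = descentLength (suc n)
  regroup : ∀ s d n → s + d + (3 * suc n + 6) ≡ (s + (3 * n + 6)) + (d + 3)
  regroup = solve-∀
  combine : ∀ p → 6 * p + 3 * (2 * p) ≡ 6 * (2 * p)
  combine = solve-∀

m+n≡o⇒m≡o∸n : ∀ {m n o} → m + n ≡ o → m ≡ o ∸ n
m+n≡o⇒m≡o∸n {m} {n} eq = trans (sym (m+n∸n≡m m n)) (cong (_∸ n) eq)

solveLength≡ : ∀ n → solveLength n ≡ 6 * 2 ^ n ∸ (3 * n + 6)
solveLength≡ n = m+n≡o⇒m≡o∸n (solveLength-closed n)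

suc-solveLength≡ : ∀ n → suc (solveLength n) ≡ 6 * 2 ^ n ∸ (3 * n + 5)
suc-solveLength≡ n = m+n≡o⇒m≡o∸n (trans (shift (solveLength n) n) (solveLength-closed n))
  where
  shift : ∀ s n → suc s + (3 * n + 5) ≡ s + (3 * n + 6)
  shift = solve-∀

theorem4p3 : (n : ℕ) → 1 ≤ n →
    Σ (Solution n) (λ s → numStates s ≡ 6 * 2 ^ n ∸ (3 * n + 5)
                          × numMoves s ≡ 6 * 2 ^ n ∸ (3 * n + 6)
                          × (∀ (t : Solution n) → numStates s ≤ numStates t))
theorem4p3 n _ =
  let s , states≡ = shortestSolution n
  in s , trans states≡ (suc-solveLength≡ n) , trans (cong (_∸ 1) states≡) (solveLength≡ n) ,
     λ t → ≤-trans (≤-reflexive states≡) (solutionBound t)
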